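{- A finite simple graph $G$ is a sesquicograph if and only if, for every non-trivial induced subgraph $H$ of $G$, the graph $H$ is not $2$-connected or the complement $\overline{H}$ is disconnected.
   Context: For vertex-disjoint graphs $G$ and $H$: the $0$-sum is their disjoint union; a $1$-sum is obtained from the disjoint union by identifying one vertex of $G$ with one vertex of $H$; the join is obtained from the disjoint union by adding all edges between $V(G)$ and $V(H)$. A sesquicograph is a graph that can be generated from the one-vertex graph $K_1$ using joins, $0$-sums and $1$-sums. A graph is trivial if it has exactly one vertex and no edges. A graph is $2$-connected if it is connected and has no cut vertex (a vertex whose deletion disconnects it). -}

module Defs where

open import Data.Nat using (ℕ; zero; suc; _+_)
open import Data.Fin using (Fin; zero; suc; splitAt; punchIn; punchOut)
open import Data.Fin.Properties using (_≟_)
open import Data.Bool using (Bool; true; false; not; _∨_; if_then_else_)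
open import Data.Maybe using (Maybe; just; nothing)
open import Data.Sum using (_⊎_; inj₁; inj₂)
open import Data.Product using (Σ; _×_)
open import Data.Empty using (⊥)
open import Relation.Nullary using (¬_; does)
open import Relation.Binary.PropositionalEquality using (_≡_)
open import Function.Bundles using (_↔_; Inverse)

Graph : ℕ → Set
Graph n = Fin n → Fin n → Bool

IsSimple : ∀ {n} → Graph n → Set
IsSimple {n} G = (∀ (x y : Fin n) → G x y ≡ G y x) × (∀ (x : Fin n) → G x x ≡ false)

complement : ∀ {n} → Graph n → Graph n
complement G x y with does (x ≟ y)
... | true  = false
... | false = not (G x y)

-- Induced subgraph on the image of a map f (used with injective f).
induced : ∀ {m n} → (Fin m → Fin n) → Graph n → Graph m
induced f G i j = G (f i) (f j)

delete : ∀ {k} → Graph (suc k) → Fin (suc k) → Graph k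
delete G v = induced (punchIn v) G

data Reach {n} (G : Graph n) : Fin n → Fin n → Set where
  here  : ∀ {x} → Reach G x x
  there : ∀ {x y z} → G x y ≡ true → Reach G y z → Reach G x z

Connected : ∀ {n} → Graph n → Set
Connected {n} G = ∀ (x y : Fin n) → Reach G x y

IsCutVertex : ∀ {k} → Graph (suc k) → Fin (suc k) → Set
IsCutVertex G v = ¬ Connected (delete G v)

TwoConnected : ∀ {k} → Graph (suc k) → Set
TwoConnected {k} G = Connected G × (∀ (v : Fin (suc k)) → ¬ IsCutVertex G v)

_≅_ : ∀ {n m} → Graph n → Graph m → Set
_≅_ {n} {m} G H = Σ (Fin n ↔ Fin m) λ φ →
  ∀ (x y : Fin n) → G x y ≡ H (Inverse.to φ x) (Inverse.to φ y)

-- Disjoint union (b = false) or join (b = true) on Fin (n + m):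
-- the first n vertices are G's, the last m are H's.
combine : ∀ {n m} → Bool → Graph n → Graph m → Graph (n + m)
combine {n} b G H x y with splitAt n x | splitAt n y
... | inj₁ i | inj₁ j = G i j
... | inj₂ i | inj₂ j = H i j
... | inj₁ _ | inj₂ _ = b
... | inj₂ _ | inj₁ _ = b

join : ∀ {n m} → Graph n → Graph m → Graph (n + m)
join = combine true

sum0 : ∀ {n m} → Graph n → Graph m → Graph (n + m)
sum0 = combine false

adjM : ∀ {k} → Graph k → Maybe (Fin k) → Maybe (Fin k) → Bool
adjM G (just i) (just j) = G i j
adjM G _ _ = false

-- 1-sum identifying vertex u of G with vertex v of H.
-- Vertex set Fin (suc a + b): the first suc a are G's vertices (u being the
-- identified vertex), the last b are H's vertices other than v (via punchIn v).
sum1 : ∀ {a b} → Graph (suc a) → Graph (suc b) → Fin (suc a) → Fin (suc b)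
     → Graph (suc a + b)
sum1 {a} {b} G H u v x y = adjM G (toG x) (toG y) ∨ adjM H (toH x) (toH y)
  where
  toG : Fin (suc a + b) → Maybe (Fin (suc a))
  toG z with splitAt (suc a) z
  ... | inj₁ i = just i
  ... | inj₂ _ = nothing
  toH : Fin (suc a + b) → Maybe (Fin (suc b))
  toH z with splitAt (suc a) z
  ... | inj₁ i = if does (i ≟ u) then just v else nothing
  ... | inj₂ j = just (punchIn v j)

K1 : Graph 1
K1 _ _ = false

data Sesquicograph : ∀ {n} → Graph n → Set where
  k1   : Sesquicograph K1
  join⁺ : ∀ {n m} {G : Graph n} {H : Graph m} →
          Sesquicograph G → Sesquicograph H → Sesquicograph (join G H)
  sum0⁺ : ∀ {n m} {G : Graph n} {H : Graph m} →
          Sesquicograph G → Sesquicograph H → Sesquicograph (sum0 G H)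
  sum1⁺ : ∀ {a b} {G : Graph (suc a)} {H : Graph (suc b)} →
          Sesquicograph G → Sesquicograph H → (u : Fin (suc a)) (v : Fin (suc b)) →
          Sesquicograph (sum1 G H u v)
  iso⁺  : ∀ {n m} {G : Graph n} {G' : Graph m} →
          Sesquicograph G → G ≅ G' → Sesquicograph G'

{-# OPTIONS --safe #-}
module Submission where

-- A sesquicograph is hereditarily decomposable: an induced subgraph of a join, 0-sum or 1-sum on
-- at least two vertices either lies inside one operand, or contains a vertex of each operand that
-- is not in the other; then its complement is disconnected (join), it is disconnected (0-sum), or
-- it is disconnected or has the identified vertex as a cut vertex (1-sum).  Conversely, by strong
-- induction on the number of vertices, a hereditarily decomposable graph G on at least two vertices
-- is disconnected, hence a 0-sum of a union of components and the rest; or has a disconnected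
-- complement, hence a join; or else, being connected but not 2-connected, has a cut vertex v and is
-- the 1-sum at v of the two sides of G - v, each with v put back.  Connectivity is decided by
-- growing the component of a vertex, which makes every case distinction constructive.

open import Defs
open import Data.Bool using (Bool; true; false; not; if_then_else_)
import Data.Bool.Properties as Bool
open import Data.Fin using (Fin; zero; suc; splitAt; _↑ˡ_; _↑ʳ_; punchIn; punchOut)
open import Data.Fin.Permutation using (Permutation′; insert; ↔⇒≡)
open import Data.Fin.Properties
  using (_≟_; any?; all?; ¬∀⟶∃¬; splitAt-↑ˡ; splitAt-↑ʳ; join-splitAt; punchIn-punchOut;
         punchInᵢ≢i; injective⇒≤; +↔⊎; nonZeroIndex)
open import Data.Fin.Subset using (Subset; _∈_; _∉_; _⊂_; _⊃_; _∪_; ⁅_⁆)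
open import Data.Fin.Subset.Induction using (⊃-wellFounded; Acc; acc)
open import Data.Fin.Subset.Properties using (_∈?_; x∈⁅x⁆; x∈⁅y⁆⇒x≡y; p⊆p∪q; q⊆p∪q; x∈p∪q⁻)
open import Data.Maybe using (Maybe; just; nothing)
open import Data.Nat using (ℕ; zero; suc; _+_; _<_; s≤s; >-nonZero⁻¹)
open import Data.Nat.Induction using (<-rec)
open import Data.Nat.Properties using (m<m+n; m<n+m)
open import Data.Product using (_×_; _,_; proj₁; proj₂; ∃; ∃-syntax)
open import Data.Sum using (_⊎_; inj₁; inj₂)
open import Data.Sum.Algebra using (⊎-cong; ⊎-comm; ⊎-assoc)
open import Data.Sum.Properties using (inj₁-injective; inj₂-injective)
open import Function using (_∘_)
open import Function.Bundles using (_↣_; Injection; mk↣; _↔_; Inverse; _⇔_; mk⇔)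
open import Function.Construct.Composition using (_↔-∘_)
open import Function.Construct.Identity using (↔-id; ↣-id)
open import Function.Construct.Symmetry using (↔-sym)
open import Function.Definitions using (Injective)
open import Function.Properties.Inverse using (↔⇒↣)
open import Level using (0ℓ)
open import Relation.Binary.PropositionalEquality
open import Relation.Nullary using (¬_; Dec; yes; no; does; contradiction)
open import Relation.Nullary.Decidable using (_×-dec_; ¬?; decidable-stable; dec-true; dec-false)

IsSymmetric : ∀ {n} → Graph n → Set
IsSymmetric {n} X = ∀ (x y : Fin n) → X x y ≡ X y x

Loopless : ∀ {n} → Graph n → Set
Loopless {n} X = ∀ (x : Fin n) → X x x ≡ false

infix 4 _≈ᴳ_
_≈ᴳ_ : ∀ {n} → Graph n → Graph n → Set
X ≈ᴳ Y = ∀ x y → X x y ≡ Y x y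

≈ᴳ-sym : ∀ {n} {X Y : Graph n} → X ≈ᴳ Y → Y ≈ᴳ X
≈ᴳ-sym X≈Y x y = sym (X≈Y x y)

induced-simple : ∀ {m n} {G : Graph n} (e : Fin m → Fin n) → IsSimple G → IsSimple (induced e G)
induced-simple e (symmetric , loopless) = (λ x y → symmetric (e x) (e y)) , (λ x → loopless (e x))

module _ {n} {X : Graph n} where

  reach-snoc : ∀ {x y z} → Reach X x y → X y z ≡ true → Reach X x z
  reach-snoc here         e = there e here
  reach-snoc (there e′ r) e = there e′ (reach-snoc r e)

  reach-trans : ∀ {x y z} → Reach X x y → Reach X y z → Reach X x z
  reach-trans here        r′ = r′
  reach-trans (there e r) r′ = there e (reach-trans r r′)

  reach-sym : IsSymmetric X → ∀ {x y} → Reach X x y → Reach X y x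
  reach-sym symmetric here                = here
  reach-sym symmetric (there {x} {y} e r) = reach-snoc (reach-sym symmetric r) (trans (symmetric y x) e)

module _ {n} {X Y : Graph n} (X≈Y : X ≈ᴳ Y) where

  reach-cong : ∀ {x y} → Reach X x y → Reach Y x y
  reach-cong here        = here
  reach-cong (there e r) = there (trans (sym (X≈Y _ _)) e) (reach-cong r)

  connected-cong : Connected X → Connected Y
  connected-cong connected x y = reach-cong (connected x y)

  complement-cong : complement X ≈ᴳ complement Y
  complement-cong x y with does (x ≟ y)
  ... | true  = refl
  ... | false = cong not (X≈Y x y)

twoConnected-cong : ∀ {k} {X Y : Graph (suc k)} → X ≈ᴳ Y → TwoConnected X → TwoConnected Y
twoConnected-cong X≈Y (connected , no-cut-vertex) =
  connected-cong X≈Y connected ,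
  λ v cut → no-cut-vertex v (cut ∘ connected-cong (λ x y → X≈Y _ _))

complement-irreflexive : ∀ {n} (X : Graph n) x → complement X x x ≡ false
complement-irreflexive X x rewrite dec-true (x ≟ x) refl = refl

complement-edge : ∀ {n} (X : Graph n) {x y} → x ≢ y → complement X x y ≡ not (X x y)
complement-edge X {x} {y} x≢y rewrite dec-false (x ≟ y) x≢y = refl

complement-false : ∀ {n} (X : Graph n) {x y} → x ≢ y → complement X x y ≡ false → X x y ≡ true
complement-false X x≢y non-edge =
  trans (sym (Bool.not-involutive _)) (cong not (trans (sym (complement-edge X x≢y)) non-edge))

complement-symmetric : ∀ {n} {X : Graph n} → IsSymmetric X → IsSymmetric (complement X)
complement-symmetric {X = X} symmetric x y = by-cases (x ≟ y)
  where
  open ≡-Reasoning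
  by-cases : Dec (x ≡ y) → complement X x y ≡ complement X y x
  by-cases (yes refl) = refl
  by-cases (no x≢y)   = begin
    complement X x y  ≡⟨ complement-edge X x≢y ⟩
    not (X x y)       ≡⟨ cong not (symmetric x y) ⟩
    not (X y x)       ≡⟨ complement-edge X (x≢y ∘ sym) ⟨
    complement X y x  ∎

complement-induced : ∀ {m n} {X : Graph n} {f : Fin m → Fin n} → Injective _≡_ _≡_ f →
                     complement (induced f X) ≈ᴳ induced f (complement X)
complement-induced {X = X} {f} f-injective x y = by-cases (x ≟ y)
  where
  by-cases : Dec (x ≡ y) → complement (induced f X) x y ≡ complement X (f x) (f y)
  by-cases (yes refl) =
    trans (complement-irreflexive (induced f X) x) (sym (complement-irreflexive X (f x)))
  by-cases (no x≢y) =
    trans (complement-edge (induced f X) x≢y) (sym (complement-edge X (x≢y ∘ f-injective)))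

record Separation {n} (X : Graph n) : Set₁ where
  field
    S       : Fin n → Set
    S?      : ∀ x → Dec (S x)
    s t     : Fin n
    s∈S     : S s
    t∉S     : ¬ S t
    no-edge : ∀ {x y} → S x → ¬ S y → X x y ≡ false

separation⇒¬connected : ∀ {n} {X : Graph n} → Separation X → ¬ Connected X
separation⇒¬connected {X = X} separation connected = t∉S (stays-in-S (connected s t) s∈S)
  where
  open Separation separation
  stays-in-S : ∀ {x y} → Reach X x y → S x → S y
  stays-in-S here        Sx = Sx
  stays-in-S (there e r) Sx = stays-in-S r (decidable-stable (S? _)
    (λ ¬Sy → contradiction (trans (sym e) (no-edge Sx ¬Sy)) λ ()))

record Component {n} (X : Graph n) (x : Fin n) : Set where
  field
    C         : Subset n
    x∈C       : x ∈ C
    reachable : ∀ {y} → y ∈ C → Reach X x y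
    closed    : ∀ {y z} → y ∈ C → X y z ≡ true → z ∈ C

component : ∀ {n} (X : Graph n) (x : Fin n) → Component X x
component {n} X x = grow ⁅ x ⁆ (⊃-wellFounded _) (x∈⁅x⁆ x)
  (λ y∈⁅x⁆ → subst (Reach X x) (sym (x∈⁅y⁆⇒x≡y x y∈⁅x⁆)) here)
  where
  Exit : Subset n → Set
  Exit C = ∃[ y ] ∃[ z ] (y ∈ C × X y z ≡ true × z ∉ C)

  exit? : ∀ C → Dec (Exit C)
  exit? C = any? λ y → any? λ z → (y ∈? C) ×-dec ((X y z Bool.≟ true) ×-dec ¬? (z ∈? C))

  grow : (C : Subset n) → Acc _⊃_ C → x ∈ C → (∀ {y} → y ∈ C → Reach X x y) → Component X x
  grow C (acc larger) x∈C reachable with exit? C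
  ... | no no-exit = record
    { C = C ; x∈C = x∈C ; reachable = reachable
    ; closed = λ {y} {z} y∈C e → decidable-stable (z ∈? C) (λ z∉C → no-exit (y , z , y∈C , e , z∉C)) }
  ... | yes (y , z , y∈C , e , z∉C) =
    grow (C ∪ ⁅ z ⁆) (larger C⊂C∪z) (p⊆p∪q ⁅ z ⁆ x∈C) reachable′
    where
    C⊂C∪z : C ⊂ C ∪ ⁅ z ⁆
    C⊂C∪z = p⊆p∪q ⁅ z ⁆ , z , q⊆p∪q C ⁅ z ⁆ (x∈⁅x⁆ z) , z∉C
    reachable′ : ∀ {w} → w ∈ C ∪ ⁅ z ⁆ → Reach X x w
    reachable′ {w} w∈ with x∈p∪q⁻ C ⁅ z ⁆ w∈
    ... | inj₁ w∈C = reachable w∈C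
    ... | inj₂ w∈z rewrite x∈⁅y⁆⇒x≡y z w∈z = reach-snoc (reachable y∈C) e

module _ {n} {X : Graph n} {x : Fin n} (K : Component X x) where
  open Component K

  component-spanning⇒connected : IsSymmetric X → (∀ y → y ∈ C) → Connected X
  component-spanning⇒connected symmetric spans y z =
    reach-trans (reach-sym symmetric (reachable (spans y))) (reachable (spans z))

  component-separation : ∀ {t} → t ∉ C → Separation X
  component-separation {t} t∉C = record
    { S = _∈ C ; S? = _∈? C ; s = x ; t = t ; s∈S = x∈C ; t∉S = t∉C
    ; no-edge = λ y∈C z∉C → Bool.¬-not (λ e → z∉C (closed y∈C e)) }

connected-or-separated : ∀ {k} {X : Graph (suc k)} → IsSymmetric X → Connected X ⊎ Separation X
connected-or-separated {X = X} symmetric = spanning-or-not (component X zero)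
  where
  spanning-or-not : Component X zero → Connected X ⊎ Separation X
  spanning-or-not K with all? (_∈? Component.C K)
  ... | yes spans = inj₁ (component-spanning⇒connected K symmetric spans)
  ... | no ¬spans = inj₂ (component-separation K (proj₂ (¬∀⟶∃¬ _ _ (_∈? _) ¬spans)))

all-or-any : ∀ {n ℓ ℓ′} {A : Fin n → Set ℓ} {B : Fin n → Set ℓ′} → (∀ i → A i ⊎ B i) →
             (∀ i → A i) ⊎ ∃ B
all-or-any {zero}  _      = inj₁ λ ()
all-or-any {suc n} choice with choice zero | all-or-any (choice ∘ suc)
... | inj₂ B0 | _            = inj₂ (zero , B0)
... | inj₁ _  | inj₂ (i , B) = inj₂ (suc i , B)
... | inj₁ A0 | inj₁ A       = inj₁ λ { zero → A0 ; (suc i) → A i }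

cut-vertex : ∀ {k} {G : Graph (suc (suc k))} → IsSymmetric G → Connected G → ¬ TwoConnected G →
  ∃[ v ] Separation (delete G v)
cut-vertex {G = G} symmetric connected ¬2-connected
  with all-or-any (λ v → connected-or-separated {X = delete G v} (λ x y → symmetric _ _))
... | inj₁ no-cut-vertex = contradiction (connected , λ v cut → cut (no-cut-vertex v)) ¬2-connected
... | inj₂ cut           = cut

Decomposable : ∀ {k} → Graph (suc (suc k)) → Set
Decomposable X = ¬ TwoConnected X ⊎ ¬ Connected (complement X)

HereditarilyDecomposable : ∀ {n} → Graph n → Set
HereditarilyDecomposable {n} G =
  ∀ m (f : Fin (suc (suc m)) ↣ Fin n) → Decomposable (induced (Injection.to f) G)

decomposable-cong : ∀ {k} {X Y : Graph (suc (suc k))} → X ≈ᴳ Y → Decomposable X → Decomposable Y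
decomposable-cong X≈Y (inj₁ ¬2-connected) = inj₁ (¬2-connected ∘ twoConnected-cong (≈ᴳ-sym X≈Y))
decomposable-cong X≈Y (inj₂ disconnectedᶜ) =
  inj₂ (disconnectedᶜ ∘ connected-cong (complement-cong (≈ᴳ-sym X≈Y)))

hereditarilyDecomposable⇒¬2-connected : ∀ {k} {G : Graph (suc (suc k))} → HereditarilyDecomposable G →
  Connected (complement G) → ¬ TwoConnected G
hereditarilyDecomposable⇒¬2-connected hd connectedᶜ with hd _ (↣-id _)
... | inj₁ ¬2-connected  = ¬2-connected
... | inj₂ disconnectedᶜ = contradiction connectedᶜ disconnectedᶜ

hereditarilyDecomposable-induced : ∀ {m n} {G : Graph n} → HereditarilyDecomposable G →
  (e : Fin m → Fin n) → Injective _≡_ _≡_ e → HereditarilyDecomposable (induced e G)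
hereditarilyDecomposable-induced hd e e-injective k f =
  hd k (mk↣ (Injection.injective f ∘ e-injective))

decomposable-within : ∀ {n p m} {X : Graph n} {G : Graph p} → HereditarilyDecomposable G →
  (e : Fin p → Fin n) → (∀ x y → X (e x) (e y) ≡ G x y) →
  (f : Fin (suc (suc m)) ↣ Fin n) → (∀ i → ∃[ y ] e y ≡ Injection.to f i) →
  Decomposable (induced (Injection.to f) X)
decomposable-within {X = X} {G} hd e e-induces f within =
  decomposable-cong same-edges (hd _ (mk↣ g-injective))
  where
  open Injection f using (to; injective)
  g = λ i → proj₁ (within i)
  e∘g : ∀ i → e (g i) ≡ to i
  e∘g i = proj₂ (within i)
  g-injective : Injective _≡_ _≡_ g
  g-injective {i} {j} gi≡gj = injective (trans (sym (e∘g i)) (trans (cong e gi≡gj) (e∘g j)))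
  same-edges : induced g G ≈ᴳ induced to X
  same-edges i j = trans (sym (e-induces (g i) (g j))) (cong₂ X (e∘g i) (e∘g j))

-- Sesquicographs are hereditarily decomposable

hereditarilyDecomposable-≅ : ∀ {n m} {G : Graph n} {G′ : Graph m} → G ≅ G′ →
  HereditarilyDecomposable G → HereditarilyDecomposable G′
hereditarilyDecomposable-≅ {G′ = G′} (φ , edges) hd _ f =
  decomposable-within {X = G′} hd (to φ) (λ x y → sym (edges x y)) f
    (λ i → from φ (Injection.to f i) , Inverse.strictlyInverseˡ φ _)
  where open Inverse

≅-loopless : ∀ {n m} {G : Graph n} {G′ : Graph m} → G ≅ G′ → Loopless G → Loopless G′
≅-loopless {G′ = G′} (φ , edges) loopless y =
  subst (λ z → G′ z z ≡ false) (Inverse.strictlyInverseˡ φ y) (trans (sym (edges _ _)) (loopless _))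

-- A join, 0-sum or 1-sum X is covered by induced copies of its two operands G and H.
record Cover {n p q} (X : Graph n) (G : Graph p) (H : Graph q) : Set where
  field
    embedˡ         : Fin p → Fin n
    embedʳ         : Fin q → Fin n
    embedˡ-induces : ∀ x y → X (embedˡ x) (embedˡ y) ≡ G x y
    embedʳ-induces : ∀ x y → X (embedʳ x) (embedʳ y) ≡ H x y
    covers         : ∀ x → (∃[ y ] embedˡ y ≡ x) ⊎ (∃[ y ] embedʳ y ≡ x)

  Inˡ Inʳ : Fin n → Set
  Inˡ x = ∃[ y ] embedˡ y ≡ x
  Inʳ x = ∃[ y ] embedʳ y ≡ x

  Inˡ? : ∀ x → Dec (Inˡ x)
  Inˡ? x = any? λ y → embedˡ y ≟ x

  Inʳ? : ∀ x → Dec (Inʳ x)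
  Inʳ? x = any? λ y → embedʳ y ≟ x

  ¬Inʳ⇒Inˡ : ∀ {x} → ¬ Inʳ x → Inˡ x
  ¬Inʳ⇒Inˡ {x} ¬Inʳx with covers x
  ... | inj₁ Inˡx = Inˡx
  ... | inj₂ Inʳx = contradiction Inʳx ¬Inʳx

  ¬Inˡ⇒Inʳ : ∀ {x} → ¬ Inˡ x → Inʳ x
  ¬Inˡ⇒Inʳ {x} ¬Inˡx with covers x
  ... | inj₁ Inˡx = contradiction Inˡx ¬Inˡx
  ... | inj₂ Inʳx = Inʳx

  loopless : Loopless G → Loopless H → Loopless X
  loopless G-loopless H-loopless x with covers x
  ... | inj₁ (y , refl) = trans (embedˡ-induces y y) (G-loopless y)
  ... | inj₂ (y , refl) = trans (embedʳ-induces y y) (H-loopless y)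

  straddling-separation : ∀ {Y : Graph n} → (∀ {x y} → ¬ Inʳ x → ¬ Inˡ y → Y x y ≡ false) →
    ∀ {r} (g : Fin r → Fin n) {i j} → ¬ Inʳ (g i) → ¬ Inˡ (g j) →
    (∀ k → Inˡ (g k) → ¬ Inʳ (g k)) → Separation (induced g Y)
  straddling-separation no-cross-edge g {i} {j} ¬Inʳgi ¬Inˡgj exclusive = record
    { S = Inˡ ∘ g ; S? = Inˡ? ∘ g ; s = i ; t = j ; s∈S = ¬Inʳ⇒Inˡ ¬Inʳgi ; t∉S = ¬Inˡgj
    ; no-edge = λ {x} Inˡgx ¬Inˡgy → no-cross-edge (exclusive x Inˡgx) ¬Inˡgy }

  module _ (G-hd : HereditarilyDecomposable G) (H-hd : HereditarilyDecomposable H) where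

    inside-or-straddling : ∀ {m} (f : Fin (suc (suc m)) ↣ Fin n) →
      Decomposable (induced (Injection.to f) X) ⊎
      ∃[ i ] ∃[ j ] (¬ Inʳ (Injection.to f i) × ¬ Inˡ (Injection.to f j))
    inside-or-straddling f with all? (Inˡ? ∘ Injection.to f) | all? (Inʳ? ∘ Injection.to f)
    ... | yes insideˡ | _ = inj₁ (decomposable-within {X = X} G-hd embedˡ embedˡ-induces f insideˡ)
    ... | no _ | yes insideʳ = inj₁ (decomposable-within {X = X} H-hd embedʳ embedʳ-induces f insideʳ)
    ... | no ¬insideˡ | no ¬insideʳ =
      let (i , ¬Inʳfi) = ¬∀⟶∃¬ _ _ (Inʳ? ∘ Injection.to f) ¬insideʳ
          (j , ¬Inˡfj) = ¬∀⟶∃¬ _ _ (Inˡ? ∘ Injection.to f) ¬insideˡ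
      in inj₂ (i , j , ¬Inʳfi , ¬Inˡfj)

↑ˡ-or-↑ʳ : ∀ n m (x : Fin (n + m)) → (∃[ i ] i ↑ˡ m ≡ x) ⊎ (∃[ j ] n ↑ʳ j ≡ x)
↑ˡ-or-↑ʳ n m x with splitAt n x | join-splitAt n m x
... | inj₁ i | i↑ˡm≡x = inj₁ (i , i↑ˡm≡x)
... | inj₂ j | n↑ʳj≡x = inj₂ (j , n↑ʳj≡x)

↑ˡ≢↑ʳ : ∀ {n m} (i : Fin n) (j : Fin m) → i ↑ˡ m ≢ n ↑ʳ j
↑ˡ≢↑ʳ {n} {m} i j eq
  with trans (sym (splitAt-↑ˡ n i m)) (trans (cong (splitAt n) eq) (splitAt-↑ʳ n m j))
... | ()

module _ {n m} (c : Bool) (G : Graph n) (H : Graph m) where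

  combine-↑ˡ : ∀ x y → combine c G H (x ↑ˡ m) (y ↑ˡ m) ≡ G x y
  combine-↑ˡ x y rewrite splitAt-↑ˡ n x m | splitAt-↑ˡ n y m = refl

  combine-↑ʳ : ∀ x y → combine c G H (n ↑ʳ x) (n ↑ʳ y) ≡ H x y
  combine-↑ʳ x y rewrite splitAt-↑ʳ n m x | splitAt-↑ʳ n m y = refl

  combine-↑ˡ↑ʳ : ∀ x y → combine c G H (x ↑ˡ m) (n ↑ʳ y) ≡ c
  combine-↑ˡ↑ʳ x y rewrite splitAt-↑ˡ n x m | splitAt-↑ʳ n m y = refl

  combine-cover : Cover (combine c G H) G H
  combine-cover = record
    { embedˡ = _↑ˡ m ; embedʳ = n ↑ʳ_
    ; embedˡ-induces = combine-↑ˡ ; embedʳ-induces = combine-↑ʳ ; covers = ↑ˡ-or-↑ʳ n m }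

  open Cover combine-cover

  combine-disjoint : ∀ {x} → Inˡ x → ¬ Inʳ x
  combine-disjoint (i , refl) (j , eq) = ↑ˡ≢↑ʳ i j (sym eq)

  combine-straddle : ∀ {x y} → ¬ Inʳ x → ¬ Inˡ y → combine c G H x y ≡ c
  combine-straddle ¬Inʳx ¬Inˡy with ¬Inʳ⇒Inˡ ¬Inʳx | ¬Inˡ⇒Inʳ ¬Inˡy
  ... | i , refl | j , refl = combine-↑ˡ↑ʳ i j

  inside-or-separated : HereditarilyDecomposable G → HereditarilyDecomposable H →
    ∀ {Y : Graph (n + m)} → (∀ {x y} → ¬ Inʳ x → ¬ Inˡ y → Y x y ≡ false) →
    ∀ {k} (f : Fin (suc (suc k)) ↣ Fin (n + m)) →
    Decomposable (induced (Injection.to f) (combine c G H)) ⊎ Separation (induced (Injection.to f) Y)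
  inside-or-separated G-hd H-hd no-cross-edge f with inside-or-straddling G-hd H-hd f
  ... | inj₁ decomposable = inj₁ decomposable
  ... | inj₂ (i , j , ¬Inʳfi , ¬Inˡfj) =
    inj₂ (straddling-separation no-cross-edge (Injection.to f) ¬Inʳfi ¬Inˡfj (λ _ → combine-disjoint))

sum0-hereditarilyDecomposable : ∀ {n m} {G : Graph n} {H : Graph m} →
  HereditarilyDecomposable G → HereditarilyDecomposable H → HereditarilyDecomposable (sum0 G H)
sum0-hereditarilyDecomposable {G = G} {H} G-hd H-hd _ f
  with inside-or-separated false G H G-hd H-hd (combine-straddle false G H) f
... | inj₁ decomposable = decomposable
... | inj₂ separation   = inj₁ (separation⇒¬connected separation ∘ proj₁)

join-straddle-complement : ∀ {n m} (G : Graph n) (H : Graph m) →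
  let open Cover (combine-cover true G H) in
  ∀ {x y} → ¬ Inʳ x → ¬ Inˡ y → complement (join G H) x y ≡ false
join-straddle-complement G H ¬Inʳx ¬Inˡy =
  trans (complement-edge (join G H) (λ { refl → ¬Inˡy (¬Inʳ⇒Inˡ ¬Inʳx) }))
        (cong not (combine-straddle true G H ¬Inʳx ¬Inˡy))
  where open Cover (combine-cover true G H)

join-hereditarilyDecomposable : ∀ {n m} {G : Graph n} {H : Graph m} →
  HereditarilyDecomposable G → HereditarilyDecomposable H → HereditarilyDecomposable (join G H)
join-hereditarilyDecomposable {G = G} {H} G-hd H-hd _ f
  with inside-or-separated true G H G-hd H-hd (join-straddle-complement G H) f
... | inj₁ decomposable = decomposable
... | inj₂ separation   =
  inj₂ (separation⇒¬connected separation ∘ connected-cong (complement-induced (Injection.injective f)))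

move-zero-to : ∀ {n} → Fin (suc n) → Permutation′ (suc n)
move-zero-to v = insert zero v (↔-id _)

module _ {a b} {G : Graph (suc a)} {H : Graph (suc b)} {u : Fin (suc a)} {v : Fin (suc b)} where

  -- The H-side name that sum1 gives to a vertex of G (only u has one).
  shared-in-H : Fin (suc a) → Maybe (Fin (suc b))
  shared-in-H x = if does (x ≟ u) then just v else nothing

  shared-in-H-edge : H v v ≡ false → ∀ x y → adjM H (shared-in-H x) (shared-in-H y) ≡ false
  shared-in-H-edge Hvv x y with does (x ≟ u) | does (y ≟ u)
  ... | true  | true  = Hvv
  ... | true  | false = refl
  ... | false | _     = refl

  sum1-↑ˡ : H v v ≡ false → ∀ x y → sum1 G H u v (x ↑ˡ b) (y ↑ˡ b) ≡ G x y
  sum1-↑ˡ Hvv x y rewrite splitAt-↑ˡ (suc a) x b | splitAt-↑ˡ (suc a) y b | shared-in-H-edge Hvv x y =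
    Bool.∨-identityʳ _

  embedʳ-sum1 : Fin (suc b) → Fin (suc a + b)
  embedʳ-sum1 zero    = u ↑ˡ b
  embedʳ-sum1 (suc q) = suc a ↑ʳ q

  H′ : Graph (suc b)
  H′ = induced (Inverse.to (move-zero-to v)) H

  H′-hereditarilyDecomposable : HereditarilyDecomposable H → HereditarilyDecomposable H′
  H′-hereditarilyDecomposable H-hd =
    hereditarilyDecomposable-induced {G = H} H-hd _ (Injection.injective (↔⇒↣ (move-zero-to v)))

  sum1-embedʳ : G u u ≡ false → ∀ x y → sum1 G H u v (embedʳ-sum1 x) (embedʳ-sum1 y) ≡ H′ x y
  sum1-embedʳ Guu zero zero
    rewrite splitAt-↑ˡ (suc a) u b | dec-true (u ≟ u) refl | Guu = refl
  sum1-embedʳ Guu zero (suc y)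
    rewrite splitAt-↑ˡ (suc a) u b | splitAt-↑ʳ (suc a) b y | dec-true (u ≟ u) refl = refl
  sum1-embedʳ Guu (suc x) zero
    rewrite splitAt-↑ˡ (suc a) u b | splitAt-↑ʳ (suc a) b x | dec-true (u ≟ u) refl = refl
  sum1-embedʳ Guu (suc x) (suc y)
    rewrite splitAt-↑ʳ (suc a) b x | splitAt-↑ʳ (suc a) b y = refl

  sum1-cover : G u u ≡ false → H v v ≡ false → Cover (sum1 G H u v) G H′
  sum1-cover Guu Hvv = record
    { embedˡ = _↑ˡ b ; embedʳ = embedʳ-sum1
    ; embedˡ-induces = sum1-↑ˡ Hvv ; embedʳ-induces = sum1-embedʳ Guu ; covers = covers }
    where
    covers : ∀ x → (∃[ p ] p ↑ˡ b ≡ x) ⊎ (∃[ q ] embedʳ-sum1 q ≡ x)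
    covers x with ↑ˡ-or-↑ʳ (suc a) b x
    ... | inj₁ Inˡx     = inj₁ Inˡx
    ... | inj₂ (q , eq) = inj₂ (suc q , eq)

  module _ (Guu : G u u ≡ false) (Hvv : H v v ≡ false) where
    open Cover (sum1-cover Guu Hvv)

    sum1-overlap : ∀ {x} → Inˡ x → x ≢ u ↑ˡ b → ¬ Inʳ x
    sum1-overlap _          x≢u↑ˡb (zero  , eq) = x≢u↑ˡb (sym eq)
    sum1-overlap (p , refl) _      (suc q , eq) = ↑ˡ≢↑ʳ p q (sym eq)

    sum1-straddle : ∀ {x y} → ¬ Inʳ x → ¬ Inˡ y → sum1 G H u v x y ≡ false
    sum1-straddle ¬Inʳx ¬Inˡy with ¬Inʳ⇒Inˡ ¬Inʳx | ¬Inˡ⇒Inʳ ¬Inˡy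
    ... | _        | zero , refl  = contradiction (u , refl) ¬Inˡy
    ... | p , refl | suc q , refl
      rewrite splitAt-↑ˡ (suc a) p b | splitAt-↑ʳ (suc a) b q
            | dec-false (p ≟ u) (λ { refl → ¬Inʳx (zero , refl) }) = refl

    sum1-hereditarilyDecomposable : HereditarilyDecomposable G → HereditarilyDecomposable H →
      HereditarilyDecomposable (sum1 G H u v)
    sum1-hereditarilyDecomposable G-hd H-hd _ f
      with inside-or-straddling G-hd (H′-hereditarilyDecomposable H-hd) f
    ... | inj₁ decomposable = decomposable
    ... | inj₂ (i , j , ¬Inʳfi , ¬Inˡfj) = inj₁ (not-2-connected (any? λ k → F k ≟ u ↑ˡ b))
      where
      open Injection f renaming (to to F)
      not-2-connected : Dec (∃[ k ] F k ≡ u ↑ˡ b) → ¬ TwoConnected (induced F (sum1 G H u v))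
      not-2-connected (no u↑ˡb∉F) (connected , _) =
        separation⇒¬connected
          (straddling-separation sum1-straddle F ¬Inʳfi ¬Inˡfj
            (λ k Inˡfk → sum1-overlap Inˡfk (λ Fk≡u↑ˡb → u↑ˡb∉F (k , Fk≡u↑ˡb))))
          connected
      not-2-connected (yes (k , Fk≡u↑ˡb)) (_ , no-cut-vertex) =
        no-cut-vertex k (separation⇒¬connected
          (straddling-separation sum1-straddle (F ∘ punchIn k) {punchOut k≢i} {punchOut k≢j}
            (subst (λ l → ¬ Inʳ (F l)) (sym (punchIn-punchOut k≢i)) ¬Inʳfi)
            (subst (λ l → ¬ Inˡ (F l)) (sym (punchIn-punchOut k≢j)) ¬Inˡfj)
            (λ l Inˡ → sum1-overlap Inˡ (λ eq → punchInᵢ≢i k l (injective (trans eq (sym Fk≡u↑ˡb)))))))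
        where
        k≢i : k ≢ i
        k≢i refl = ¬Inʳfi (zero , sym Fk≡u↑ˡb)
        k≢j : k ≢ j
        k≢j refl = ¬Inˡfj (u , sym Fk≡u↑ˡb)

sesquicograph-loopless : ∀ {n} {G : Graph n} → Sesquicograph G → Loopless G
sesquicograph-loopless k1 _ = refl
sesquicograph-loopless (join⁺ {G = G} {H} sG sH) =
  Cover.loopless (combine-cover true G H) (sesquicograph-loopless sG) (sesquicograph-loopless sH)
sesquicograph-loopless (sum0⁺ {G = G} {H} sG sH) =
  Cover.loopless (combine-cover false G H) (sesquicograph-loopless sG) (sesquicograph-loopless sH)
sesquicograph-loopless (sum1⁺ sG sH u v) =
  Cover.loopless (sum1-cover (G-loopless u) (H-loopless v)) G-loopless
    (H-loopless ∘ Inverse.to (move-zero-to v))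
  where
  G-loopless = sesquicograph-loopless sG
  H-loopless = sesquicograph-loopless sH
sesquicograph-loopless (iso⁺ {G' = G′} sG G≅G′) = ≅-loopless {G′ = G′} G≅G′ (sesquicograph-loopless sG)

sesquicograph⇒hereditarilyDecomposable : ∀ {n} {G : Graph n} → Sesquicograph G →
  HereditarilyDecomposable G
sesquicograph⇒hereditarilyDecomposable k1 _ f =
  contradiction (injective⇒≤ (Injection.injective f)) λ { (s≤s ()) }
sesquicograph⇒hereditarilyDecomposable (join⁺ sG sH) =
  join-hereditarilyDecomposable
    (sesquicograph⇒hereditarilyDecomposable sG) (sesquicograph⇒hereditarilyDecomposable sH)
sesquicograph⇒hereditarilyDecomposable (sum0⁺ sG sH) =
  sum0-hereditarilyDecomposable
    (sesquicograph⇒hereditarilyDecomposable sG) (sesquicograph⇒hereditarilyDecomposable sH)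
sesquicograph⇒hereditarilyDecomposable (sum1⁺ sG sH u v) =
  sum1-hereditarilyDecomposable (sesquicograph-loopless sG u) (sesquicograph-loopless sH v)
    (sesquicograph⇒hereditarilyDecomposable sG) (sesquicograph⇒hereditarilyDecomposable sH)
sesquicograph⇒hereditarilyDecomposable (iso⁺ {G' = G′} sG G≅G′) =
  hereditarilyDecomposable-≅ {G′ = G′} G≅G′ (sesquicograph⇒hereditarilyDecomposable sG)

-- Hereditarily decomposable graphs are sesquicographs

record Partition {n} (P : Fin n → Set) : Set where
  field
    {a b}   : ℕ
    φ       : (Fin a ⊎ Fin b) ↔ Fin n
    inside  : ∀ i → P (Inverse.to φ (inj₁ i))
    outside : ∀ j → ¬ P (Inverse.to φ (inj₂ j))

  φ-injective : Injective _≡_ _≡_ (Inverse.to φ)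
  φ-injective = Injection.injective (↔⇒↣ φ)

  size : a + b ≡ n
  size = ↔⇒≡ (φ ↔-∘ +↔⊎)

  inside-index : ∀ {x} → P x → Fin a
  inside-index {x} Px with Inverse.from φ x | Inverse.strictlyInverseˡ φ x
  ... | inj₁ i | _      = i
  ... | inj₂ j | to-j≡x = contradiction (subst P (sym to-j≡x) Px) (outside j)

  outside-index : ∀ {x} → ¬ P x → Fin b
  outside-index {x} ¬Px with Inverse.from φ x | Inverse.strictlyInverseˡ φ x
  ... | inj₁ i | to-i≡x = contradiction (subst P to-i≡x (inside i)) ¬Px
  ... | inj₂ j | _      = j

  inside-smaller : Fin b → a < n
  inside-smaller j = subst (a <_) size (m<m+n a (>-nonZero⁻¹ b ⦃ nonZeroIndex j ⦄))

  outside-smaller : Fin a → b < n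
  outside-smaller i = subst (b <_) size (m<n+m b (>-nonZero⁻¹ a ⦃ nonZeroIndex i ⦄))

⊎-suc-cong : ∀ {a b n} → (Fin a ⊎ Fin b) ↔ Fin n → (Fin (suc a) ⊎ Fin b) ↔ Fin (suc n)
⊎-suc-cong {a} {b} {n} φ =
  ↔-sym (+↔⊎ {1} {n}) ↔-∘
    (⊎-cong (↔-id _) φ ↔-∘ (⊎-assoc 0ℓ (Fin 1) (Fin a) (Fin b) ↔-∘ ⊎-cong (+↔⊎ {1} {a}) (↔-id _)))

partition-suc : ∀ {n} {P : Fin (suc n) → Set} → P zero → Partition (P ∘ suc) → Partition P
partition-suc P0 Π = record
  { φ = ⊎-suc-cong φ ; inside = λ { zero → P0 ; (suc i) → inside i } ; outside = outside }
  where open Partition Π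

partition-swap : ∀ {n} {P : Fin n → Set} → (∀ x → Dec (P x)) → Partition (¬_ ∘ P) → Partition P
partition-swap P? Π = record
  { φ = φ ↔-∘ ⊎-comm _ _ ; inside = λ j → decidable-stable (P? _) (outside j) ; outside = inside }
  where open Partition Π

partition : ∀ {n} {P : Fin n → Set} → (∀ x → Dec (P x)) → Partition P
partition {zero} _ = record { φ = ↔-sym (+↔⊎ {0} {0}) ; inside = λ () ; outside = λ () }
partition {suc n} P? with P? zero
... | yes P0  = partition-suc P0 (partition (P? ∘ suc))
... | no  ¬P0 = partition-swap P? (partition-suc ¬P0 (partition (¬? ∘ P? ∘ suc)))

module _ {n} {G : Graph n} (symmetric : IsSymmetric G) {P : Fin n → Set} (Π : Partition P) where
  open Partition Π

  combine-partition-≅ : ∀ c → (∀ i j → G (Inverse.to φ (inj₁ i)) (Inverse.to φ (inj₂ j)) ≡ c) →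
    combine c (induced (Inverse.to φ ∘ inj₁) G) (induced (Inverse.to φ ∘ inj₂) G) ≅ G
  combine-partition-≅ c cross = φ ↔-∘ +↔⊎ , edges
    where
    edges : ∀ x y → combine c (induced (Inverse.to φ ∘ inj₁) G) (induced (Inverse.to φ ∘ inj₂) G) x y
                  ≡ G (Inverse.to φ (splitAt a x)) (Inverse.to φ (splitAt a y))
    edges x y with splitAt a x | splitAt a y
    ... | inj₁ i | inj₁ j = refl
    ... | inj₁ i | inj₂ j = sym (cross i j)
    ... | inj₂ i | inj₁ j = sym (trans (symmetric _ _) (cross j i))
    ... | inj₂ i | inj₂ j = refl

with-v : ∀ {a b} → Fin (suc b) → Fin (suc a) ⊎ Fin b
with-v zero    = inj₁ zero
with-v (suc j) = inj₂ j

with-v-injective : ∀ {a b} → Injective _≡_ _≡_ (with-v {a} {b})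
with-v-injective {x = zero}  {zero}  _    = refl
with-v-injective {x = suc i} {suc j} refl = refl

module _ {n} (v : Fin (suc n)) {P : Fin n → Set} (Π : Partition P) where
  open Partition Π

  -- Π partitions the vertices of G - v; π puts v back as the shared vertex inj₁ zero.
  π : (Fin (suc a) ⊎ Fin b) ↔ Fin (suc n)
  π = move-zero-to v ↔-∘ ⊎-suc-cong φ

  π-injective : Injective _≡_ _≡_ (Inverse.to π)
  π-injective = Injection.injective (↔⇒↣ π)

  sum1-partition-≅ : ∀ {G : Graph (suc n)} → IsSymmetric G → G v v ≡ false →
    (∀ i j → G (punchIn v (Inverse.to φ (inj₁ i))) (punchIn v (Inverse.to φ (inj₂ j))) ≡ false) →
    sum1 (induced (Inverse.to π ∘ inj₁) G) (induced (Inverse.to π ∘ with-v) G) zero zero ≅ G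
  sum1-partition-≅ {G} symmetric Gvv cross = π ↔-∘ +↔⊎ , edges
    where
    edges : ∀ x y →
      sum1 (induced (Inverse.to π ∘ inj₁) G) (induced (Inverse.to π ∘ with-v) G) zero zero x y
        ≡ G (Inverse.to π (splitAt (suc a) x)) (Inverse.to π (splitAt (suc a) y))
    edges x y with splitAt (suc a) x | splitAt (suc a) y
    ... | inj₁ zero    | inj₁ zero    rewrite Gvv = refl
    ... | inj₁ zero    | inj₁ (suc j) = Bool.∨-identityʳ _
    ... | inj₁ (suc i) | inj₁ _       = Bool.∨-identityʳ _
    ... | inj₁ zero    | inj₂ j       = refl
    ... | inj₁ (suc i) | inj₂ j       = sym (cross i j)
    ... | inj₂ j       | inj₁ zero    = refl
    ... | inj₂ j       | inj₁ (suc i) = sym (trans (symmetric _ _) (cross i j))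
    ... | inj₂ i       | inj₂ j       = refl

Buildable : ℕ → Set
Buildable n = (G : Graph n) → Fin n → IsSimple G → HereditarilyDecomposable G → Sesquicograph G

module _ {n} (IH : ∀ {k} → k < n → Buildable k)
         {G : Graph n} (simple : IsSimple G) (hd : HereditarilyDecomposable G) where

  induced-sesquicograph : ∀ {k} (e : Fin k → Fin n) → Injective _≡_ _≡_ e → Fin k → k < n →
    Sesquicograph (induced e G)
  induced-sesquicograph e e-injective x k<n =
    IH k<n (induced e G) x (induced-simple e simple)
      (hereditarilyDecomposable-induced {G = G} hd e e-injective)

  separation-halves : ∀ {X : Graph n} c (separation : Separation X) →
    (∀ {x y} → Separation.S separation x → ¬ Separation.S separation y → G x y ≡ c) →
    let open Partition (partition (Separation.S? separation)) in
    Sesquicograph (induced (Inverse.to φ ∘ inj₁) G) × Sesquicograph (induced (Inverse.to φ ∘ inj₂) G)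
      × combine c (induced (Inverse.to φ ∘ inj₁) G) (induced (Inverse.to φ ∘ inj₂) G) ≅ G
  separation-halves c separation cross =
    induced-sesquicograph (Inverse.to φ ∘ inj₁) (inj₁-injective ∘ φ-injective) s′ (inside-smaller t′) ,
    induced-sesquicograph (Inverse.to φ ∘ inj₂) (inj₂-injective ∘ φ-injective) t′ (outside-smaller s′) ,
    combine-partition-≅ (proj₁ simple) Π c (λ i j → cross (inside i) (outside j))
    where
    open Separation separation
    Π = partition S?
    open Partition Π
    s′ = inside-index s∈S
    t′ = outside-index t∉S

  sum0-of-separation : Separation G → Sesquicograph G
  sum0-of-separation separation with separation-halves false separation (Separation.no-edge separation)
  ... | A , B , A+B≅G = iso⁺ (sum0⁺ A B) A+B≅G

  join-of-separation : Separation (complement G) → Sesquicograph G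
  join-of-separation separation with separation-halves true separation edge
    where
    open Separation separation
    edge : ∀ {x y} → S x → ¬ S y → G x y ≡ true
    edge Sx ¬Sy = complement-false G (λ { refl → ¬Sy Sx }) (no-edge Sx ¬Sy)
  ... | A , B , A+B≅G = iso⁺ (join⁺ A B) A+B≅G

module _ {m} (IH : ∀ {k} → k < suc m → Buildable k)
         {G : Graph (suc m)} (simple : IsSimple G) (hd : HereditarilyDecomposable G) where

  sum1-of-separation : ∀ v → Separation (delete G v) → Sesquicograph G
  sum1-of-separation v separation =
    iso⁺ (sum1⁺ A B zero zero)
      (sum1-partition-≅ v Π (proj₁ simple) (proj₂ simple v) (λ i j → no-edge (inside i) (outside j)))
    where
    open Separation separation
    Π = partition S?
    open Partition Π
    A = induced-sesquicograph IH simple hd (Inverse.to (π v Π) ∘ inj₁)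
          (inj₁-injective ∘ π-injective v Π) zero (s≤s (inside-smaller (outside-index t∉S)))
    B = induced-sesquicograph IH simple hd (Inverse.to (π v Π) ∘ with-v)
          (with-v-injective ∘ π-injective v Π) zero (s≤s (outside-smaller (inside-index s∈S)))

hereditarilyDecomposable⇒sesquicograph : ∀ n → Buildable n
hereditarilyDecomposable⇒sesquicograph = <-rec Buildable build
  where
  build : ∀ n → (∀ {k} → k < n → Buildable k) → Buildable n
  build (suc zero) _ G _ (_ , loopless) _ = iso⁺ k1 (↔-id _ , λ { zero zero → sym (loopless zero) })
  build (suc (suc m)) IH G _ simple@(symmetric , _) hd with connected-or-separated symmetric
  ... | inj₂ separation = sum0-of-separation IH simple hd separation
  ... | inj₁ connected with connected-or-separated (complement-symmetric symmetric)
  ... | inj₂ separationᶜ = join-of-separation IH simple hd separationᶜ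
  ... | inj₁ connectedᶜ
    with cut-vertex symmetric connected (hereditarilyDecomposable⇒¬2-connected hd connectedᶜ)
  ... | v , separation = sum1-of-separation IH simple hd v separation

proposition2p5 : ∀ (n : ℕ) (G : Graph (suc n)) → IsSimple G →
    Sesquicograph G ⇔
      (∀ (m : ℕ) (f : Fin (suc (suc m)) ↣ Fin (suc n)) →
        ¬ TwoConnected (induced (Injection.to f) G)
          ⊎ ¬ Connected (complement (induced (Injection.to f) G)))
proposition2p5 n G simple =
  mk⇔ sesquicograph⇒hereditarilyDecomposable
      (hereditarilyDecomposable⇒sesquicograph (suc n) G zero simple)
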